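{- Let $m_1\leqslant\dots\leqslant m_r$ be positive integers and suppose there are finite multisets $V_+$ and $V_-$ of positive integers such that $$\sum_{i=1}^r q^{m_i}=\frac{q\prod_{v\in V_+}(1-q^v)}{\prod_{v\in V_- }(1-q^v)}.$$ Then $\prod_{v\in V_+}v=r\prod_{v\in V_- }v$ and $|V_+|=|V_-|$.
   Context: Products and cardinalities over multisets are taken with multiplicity. The displayed identity is an identity of rational functions in $q$. -}

module Defs where

open import Data.Nat using (ℕ; zero; suc; _∸_; _≟_)
open import Data.Integer using (ℤ; _+_; _*_; _-_; 0ℤ; 1ℤ)
open import Data.List using (List; []; _∷_; foldr; map; upTo)
open import Data.Fin using (Fin)
open import Data.Vec.Functional using (toList)
open import Relation.Nullary.Decidable using (does)
open import Data.Bool using (if_then_else_)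

-- Polynomials in q with integer coefficients, represented by their
-- coefficient sequence: f n = coefficient of q^n.  (All polynomials
-- built below have finite support.)
Poly : Set
Poly = ℕ → ℤ

_*P_ : Poly → Poly → Poly
(f *P g) n = foldr _+_ 0ℤ (map (λ k → f k * g (n ∸ k)) (upTo (suc n)))

_+P_ : Poly → Poly → Poly
(f +P g) n = f n + g n

0P : Poly
0P _ = 0ℤ

qPow : ℕ → Poly
qPow m n = if does (n ≟ m) then 1ℤ else 0ℤ

oneMinusQPow : ℕ → Poly
oneMinusQPow v n = qPow 0 n - qPow v n

prodOneMinus : List ℕ → Poly
prodOneMinus V = foldr (λ v acc → oneMinusQPow v *P acc) (qPow 0) V

sumQPow : List ℕ → Poly
sumQPow ms = foldr (λ m acc → qPow m +P acc) 0P ms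

module Submission where

-- Write Δ for multiplication by (1 - q), i.e. (Δ f)ₙ = fₙ - fₙ₋₁, and
-- [v] = 1 + q + ⋯ + q^(v-1).  Since 1 - q^v = [v] · (1 - q), the hypothesis
--     S · Π_{V₋} (1 - q^v) = q · Π_{V₊} (1 - q^v),    S = Σᵢ q^(mᵢ),
-- becomes  Δ^|V₋| (S · Q₋) = Δ^|V₊| (q · Q₊)  with  Q± = Π_{v ∈ V±} [v].
-- Since S(1) = r and Q±(1) = Π V±, the theorem follows for r ≥ 1; the case
-- r = 0 is refuted by comparing the coefficients of q¹.

open import Defs
open import Data.Nat as ℕ
  using (ℕ; zero; suc; _∸_; _≤_; z≤n; s≤s; NonZero; >-nonZero; ≢-nonZero⁻¹; compare; less; equal; greater)
open import Data.Nat.Properties using (≤-trans; ≤-refl; m≤m+n; m≤n+m; n≤1+n; m*n≢0)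
open import Data.Nat.ListAction using (product)
open import Data.Nat.ListAction.Properties using (product≢0)
open import Data.Integer using (ℤ; _+_; _*_; _-_; 0ℤ; 1ℤ; +_)
open import Data.Integer.Properties using (pos-*; +-injective; *-identityˡ; *-zeroʳ)
open import Data.Integer.Tactic.RingSolver using (solve-∀)
open import Data.List using (List; []; _∷_; foldr; length)
open import Data.List.Properties using (map-applyUpTo; length-tabulate)
open import Data.List.Relation.Unary.All as All using (All; []; _∷_)
open import Data.Fin using (Fin; toℕ)
open import Data.Vec.Functional using (toList)
open import Data.Product using (_×_; _,_)
open import Relation.Nullary using (contradiction)
open import Relation.Binary.PropositionalEquality

infix 4 _≈_
_≈_ : Poly → Poly → Set
f ≈ g = ∀ n → f n ≡ g n

tail : Poly → Poly
tail f k = f (suc k)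

*P-suc : ∀ f g n → (f *P g) (suc n) ≡ f 0 * g (suc n) + (tail f *P g) n
*P-suc f g n = cong (λ xs → f 0 * g (suc n) + foldr _+_ 0ℤ xs)
  (trans (map-applyUpTo suc (λ k → f k * g (suc n ∸ k)) (suc n))
         (sym (map-applyUpTo (λ k → k) (λ k → tail f k * g (n ∸ k)) (suc n))))

*P-congʳ : ∀ f {g h} → g ≈ h → f *P g ≈ f *P h
*P-congʳ f g≈h zero = cong (λ a → f 0 * a + 0ℤ) (g≈h 0)
*P-congʳ f {g} {h} g≈h (suc n) = begin
  (f *P g) (suc n)                   ≡⟨ *P-suc f g n ⟩
  f 0 * g (suc n) + (tail f *P g) n  ≡⟨ cong₂ (λ a b → f 0 * a + b) (g≈h (suc n)) (*P-congʳ (tail f) g≈h n) ⟩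
  f 0 * h (suc n) + (tail f *P h) n  ≡⟨ sym (*P-suc f h n) ⟩
  (f *P h) (suc n)                   ∎
  where open ≡-Reasoning

*P-zeroˡ : ∀ f g → f ≈ 0P → f *P g ≈ 0P
*P-zeroˡ f g f≈0 zero = cong (λ a → a * g 0 + 0ℤ) (f≈0 0)
*P-zeroˡ f g f≈0 (suc n) = trans (*P-suc f g n)
  (cong₂ _+_ (cong (_* g (suc n)) (f≈0 0)) (*P-zeroˡ (tail f) g (λ k → f≈0 (suc k)) n))

shift : ℕ → Poly → Poly
shift zero h n = h n
shift (suc k) h zero = 0ℤ
shift (suc k) h (suc n) = shift k h n

*P-qPowˡ : ∀ k h → qPow k *P h ≈ shift k h
*P-qPowˡ zero h zero = unit (h 0)
  where
  unit : ∀ x → 1ℤ * x + 0ℤ ≡ x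
  unit = solve-∀
*P-qPowˡ (suc k) h zero = refl
*P-qPowˡ zero h (suc n) = trans (*P-suc (qPow 0) h n)
  (trans (cong (_+_ (1ℤ * h (suc n))) (*P-zeroˡ (tail (qPow 0)) h (λ _ → refl) n)) (unit (h (suc n))))
  where
  unit : ∀ x → 1ℤ * x + 0ℤ ≡ x
  unit = solve-∀
*P-qPowˡ (suc k) h (suc n) = trans (*P-suc (qPow (suc k)) h n) (trans (absorb (h (suc n)) _) (*P-qPowˡ k h n))
  where
  absorb : ∀ x y → 0ℤ * x + y ≡ y
  absorb = solve-∀

*P-subˡ : ∀ f g h → (λ k → f k - g k) *P h ≈ λ n → (f *P h) n - (g *P h) n
*P-subˡ f g h zero = distrib (f 0) (g 0) (h 0)
  where
  distrib : ∀ a b c → (a - b) * c + 0ℤ ≡ (a * c + 0ℤ) - (b * c + 0ℤ)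
  distrib = solve-∀
*P-subˡ f g h (suc n) = begin
  ((λ k → f k - g k) *P h) (suc n)
    ≡⟨ *P-suc (λ k → f k - g k) h n ⟩
  (f 0 - g 0) * h (suc n) + ((λ k → f (suc k) - g (suc k)) *P h) n
    ≡⟨ cong (_+_ ((f 0 - g 0) * h (suc n))) (*P-subˡ (tail f) (tail g) h n) ⟩
  (f 0 - g 0) * h (suc n) + ((tail f *P h) n - (tail g *P h) n)
    ≡⟨ distrib (f 0) (g 0) (h (suc n)) _ _ ⟩
  (f 0 * h (suc n) + (tail f *P h) n) - (g 0 * h (suc n) + (tail g *P h) n)
    ≡⟨ sym (cong₂ _-_ (*P-suc f h n) (*P-suc g h n)) ⟩
  (f *P h) (suc n) - (g *P h) (suc n) ∎
  where
  open ≡-Reasoning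
  distrib : ∀ a b c p p' → (a - b) * c + (p - p') ≡ (a * c + p) - (b * c + p')
  distrib = solve-∀

Δ : Poly → Poly
Δ g zero = g zero
Δ g (suc n) = g (suc n) - g n

Δ-cong : ∀ {f g} → f ≈ g → Δ f ≈ Δ g
Δ-cong f≈g zero = f≈g zero
Δ-cong f≈g (suc n) = cong₂ _-_ (f≈g (suc n)) (f≈g n)

Δ-injective : ∀ {f g} → Δ f ≈ Δ g → f ≈ g
Δ-injective e zero = e zero
Δ-injective {f} {g} e (suc n) =
  cancel (trans (e (suc n)) (cong (g (suc n) -_) (sym (Δ-injective e n))))
  where
  cancel : ∀ {x y z} → x - y ≡ z - y → x ≡ z
  cancel {x} {y} {z} eq = begin
    x            ≡⟨ split x y ⟩
    (x - y) + y  ≡⟨ cong (_+ y) eq ⟩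
    (z - y) + y  ≡⟨ sym (split z y) ⟩
    z            ∎
    where
    open ≡-Reasoning
    split : ∀ a b → a ≡ (a - b) + b
    split = solve-∀

Δ-*P-suc : ∀ f g n → Δ (f *P g) (suc n) ≡ f 0 * Δ g (suc n) + Δ (tail f *P g) n
Δ-*P-suc f g zero =
  trans (cong (_- (f 0 * g 0 + 0ℤ)) (*P-suc f g 0)) (regroup (f 0) (g 1) (g 0) _)
  where
  regroup : ∀ a x y p → (a * x + p) - (a * y + 0ℤ) ≡ a * (x - y) + p
  regroup = solve-∀
Δ-*P-suc f g (suc n) =
  trans (cong₂ _-_ (*P-suc f g (suc n)) (*P-suc f g n)) (regroup (f 0) (g (2 ℕ.+ n)) (g (suc n)) _ _)
  where
  regroup : ∀ a x y p p' → (a * x + p) - (a * y + p') ≡ a * (x - y) + (p - p')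
  regroup = solve-∀

Δ-*P : ∀ f g → Δ (f *P g) ≈ f *P Δ g
Δ-*P f g zero = refl
Δ-*P f g (suc n) = begin
  Δ (f *P g) (suc n)                       ≡⟨ Δ-*P-suc f g n ⟩
  f 0 * Δ g (suc n) + Δ (tail f *P g) n    ≡⟨ cong (_+_ (f 0 * Δ g (suc n))) (Δ-*P (tail f) g n) ⟩
  f 0 * Δ g (suc n) + (tail f *P Δ g) n    ≡⟨ sym (*P-suc f (Δ g) n) ⟩
  (f *P Δ g) (suc n)                       ∎
  where open ≡-Reasoning

Δⁿ : ℕ → Poly → Poly
Δⁿ zero f = f
Δⁿ (suc k) f = Δ (Δⁿ k f)

Δⁿ-injective : ∀ k {f g} → Δⁿ k f ≈ Δⁿ k g → f ≈ g
Δⁿ-injective zero e = e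
Δⁿ-injective (suc k) e = Δⁿ-injective k (Δ-injective e)

Δⁿ-*P : ∀ k f g → f *P Δⁿ k g ≈ Δⁿ k (f *P g)
Δⁿ-*P zero f g n = refl
Δⁿ-*P (suc k) f g n = trans (sym (Δ-*P f (Δⁿ k g) n)) (Δ-cong (Δⁿ-*P k f g) n)

Δⁿ-peel : ∀ a k f → Δⁿ (suc (a ℕ.+ k)) f ≡ Δⁿ a (Δ (Δⁿ k f))
Δⁿ-peel zero k f = refl
Δⁿ-peel (suc a) k f = cong Δ (Δⁿ-peel a k f)

geom : ℕ → Poly
geom zero n = 0ℤ
geom (suc v) zero = 1ℤ
geom (suc v) (suc n) = geom v n

geom-*P-Δ : ∀ v h → geom v *P Δ h ≈ λ n → h n - shift v h n
geom-*P-Δ zero h n = trans (*P-zeroˡ (geom 0) (Δ h) (λ _ → refl) n) (self-sub (h n))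
  where
  self-sub : ∀ x → 0ℤ ≡ x - x
  self-sub = solve-∀
geom-*P-Δ (suc v) h zero = unit (h 0)
  where
  unit : ∀ x → 1ℤ * x + 0ℤ ≡ x - 0ℤ
  unit = solve-∀
geom-*P-Δ (suc v) h (suc n) = trans (*P-suc (geom (suc v)) (Δ h) n)
  (trans (cong (_+_ (1ℤ * (h (suc n) - h n))) (geom-*P-Δ v h n)) (telescope (h (suc n)) (h n) (shift v h n)))
  where
  telescope : ∀ x y z → 1ℤ * (x - y) + (y - z) ≡ x - z
  telescope = solve-∀

oneMinusQPow-*P : ∀ v h → oneMinusQPow v *P h ≈ geom v *P Δ h
oneMinusQPow-*P v h n = trans (*P-subˡ (qPow 0) (qPow v) h n)
  (trans (cong₂ _-_ (*P-qPowˡ 0 h n) (*P-qPowˡ v h n)) (sym (geom-*P-Δ v h n)))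

Q : List ℕ → Poly
Q [] = qPow 0
Q (v ∷ V) = geom v *P Q V

prodOneMinus≈Δⁿ : ∀ V → prodOneMinus V ≈ Δⁿ (length V) (Q V)
prodOneMinus≈Δⁿ [] n = refl
prodOneMinus≈Δⁿ (v ∷ V) n = begin
  (oneMinusQPow v *P prodOneMinus V) n   ≡⟨ oneMinusQPow-*P v (prodOneMinus V) n ⟩
  (geom v *P Δ (prodOneMinus V)) n       ≡⟨ *P-congʳ (geom v) (Δ-cong (prodOneMinus≈Δⁿ V)) n ⟩
  (geom v *P Δⁿ (suc (length V)) (Q V)) n ≡⟨ Δⁿ-*P (suc (length V)) (geom v) (Q V) n ⟩
  Δⁿ (suc (length V)) (Q (v ∷ V)) n      ∎
  where open ≡-Reasoning

*P-prodOneMinus : ∀ f V → f *P prodOneMinus V ≈ Δⁿ (length V) (f *P Q V)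
*P-prodOneMinus f V n = trans (*P-congʳ f (prodOneMinus≈Δⁿ V) n) (Δⁿ-*P (length V) f (Q V) n)

prodOneMinus-constant : ∀ {V} → All (1 ≤_) V → prodOneMinus V 0 ≡ 1ℤ
prodOneMinus-constant [] = refl
prodOneMinus-constant {suc v ∷ V} (_ ∷ pos) = cong (λ t → (1ℤ - 0ℤ) * t + 0ℤ) (prodOneMinus-constant pos)

StableFrom : Poly → ℕ → ℤ → Set
StableFrom h N c = ∀ n → N ≤ n → h n ≡ c

stable-weaken : ∀ {h N M c} → N ≤ M → StableFrom h N c → StableFrom h M c
stable-weaken N≤M st n M≤n = st n (≤-trans N≤M M≤n)

-- Partial sums PS f n = f₀ + ⋯ + fₙ; PS is multiplication by 1/(1 - q),
-- and f(1) will be read off as the eventual value of PS f.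
PS : Poly → Poly
PS f zero = f zero
PS f (suc n) = PS f n + f (suc n)

PS-cong : ∀ {f g} → f ≈ g → PS f ≈ PS g
PS-cong f≈g zero = f≈g zero
PS-cong f≈g (suc n) = cong₂ _+_ (PS-cong f≈g n) (f≈g (suc n))

PS-zero : ∀ {f} → f ≈ 0P → PS f ≈ 0P
PS-zero f≈0 zero = f≈0 zero
PS-zero f≈0 (suc n) = cong₂ _+_ (PS-zero f≈0 n) (f≈0 (suc n))

Δ-PS : ∀ h → Δ (PS h) ≈ h
Δ-PS h zero = refl
Δ-PS h (suc n) = cancel (PS h n) (h (suc n))
  where
  cancel : ∀ x y → (x + y) - x ≡ y
  cancel = solve-∀

PS-Δ : ∀ h → PS (Δ h) ≈ h
PS-Δ h zero = refl
PS-Δ h (suc n) = trans (cong (_+ (h (suc n) - h n)) (PS-Δ h n)) (cancel (h n) (h (suc n)))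
  where
  cancel : ∀ x y → x + (y - x) ≡ y
  cancel = solve-∀

-- Summation commutes with multiplication: both sides have Δ equal to f · g.
PS-*P : ∀ f g → PS (f *P g) ≈ f *P PS g
PS-*P f g = Δ-injective λ n →
  trans (Δ-PS (f *P g) n) (sym (trans (Δ-*P f (PS g) n) (*P-congʳ f (Δ-PS g) n)))

PS-+P : ∀ f g → PS (f +P g) ≈ λ n → PS f n + PS g n
PS-+P f g zero = refl
PS-+P f g (suc n) = trans (cong (_+ (f (suc n) + g (suc n))) (PS-+P f g n))
  (interchange (PS f n) (PS g n) (f (suc n)) (g (suc n)))
  where
  interchange : ∀ a b c d → (a + b) + (c + d) ≡ (a + c) + (b + d)
  interchange = solve-∀

PS-suc : ∀ f n → PS f (suc n) ≡ f 0 + PS (tail f) n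
PS-suc f zero = refl
PS-suc f (suc n) = trans (cong (_+ f (2 ℕ.+ n)) (PS-suc f n))
  (assoc (f 0) (PS (tail f) n) (f (2 ℕ.+ n)))
  where
  assoc : ∀ x y z → (x + y) + z ≡ x + (y + z)
  assoc = solve-∀

sumTo : ℕ → Poly → ℤ
sumTo zero f = 0ℤ
sumTo (suc A) f = f 0 + sumTo A (tail f)

PS-stable : ∀ A f → StableFrom f A 0ℤ → StableFrom (PS f) A (sumTo A f)
PS-stable zero f van n _ = PS-zero (λ k → van k z≤n) n
PS-stable (suc A) f van (suc n) (s≤s A≤n) = trans (PS-suc f n)
  (cong (_+_ (f 0)) (PS-stable A (tail f) (λ k le → van (suc k) (s≤s le)) n A≤n))

*P-stable : ∀ A B f h β → StableFrom f A 0ℤ → StableFrom h B β →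
            StableFrom (f *P h) (A ℕ.+ B) (sumTo A f * β)
*P-stable zero B f h β van st n _ = *P-zeroˡ f h (λ k → van k z≤n) n
*P-stable (suc A) B f h β van st (suc n) (s≤s A+B≤n) = begin
  (f *P h) (suc n)                      ≡⟨ *P-suc f h n ⟩
  f 0 * h (suc n) + (tail f *P h) n     ≡⟨ cong₂ (λ a b → f 0 * a + b) (st (suc n) B≤1+n)
                                            (*P-stable A B (tail f) h β (λ k le → van (suc k) (s≤s le)) st n A+B≤n) ⟩
  f 0 * β + sumTo A (tail f) * β        ≡⟨ distrib (f 0) (sumTo A (tail f)) β ⟩
  sumTo (suc A) f * β                   ∎
  where
  open ≡-Reasoning
  B≤1+n : B ≤ suc n
  B≤1+n = ≤-trans (m≤n+m B A) (≤-trans A+B≤n (n≤1+n n))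
  distrib : ∀ x y b → x * b + y * b ≡ (x + y) * b
  distrib = solve-∀

-- AtOne f c: f is finitely supported and f(1) = c, witnessed by a bound
-- beyond which f vanishes and its partial sums equal c.
record AtOne (f : Poly) (c : ℤ) : Set where
  field
    bound    : ℕ
    vanishes : StableFrom f bound 0ℤ
    sums     : StableFrom (PS f) bound c
open AtOne

AtOne-total : ∀ {f} N → StableFrom f N 0ℤ → AtOne f (sumTo N f)
AtOne-total {f} N van = record { bound = N ; vanishes = van ; sums = PS-stable N f van }

AtOne-unique : ∀ {f g c d} → AtOne f c → AtOne g d → f ≈ g → c ≡ d
AtOne-unique ef eg f≈g = trans (sym (sums ef N (m≤m+n _ _)))
  (trans (PS-cong f≈g N) (sums eg N (m≤n+m _ _)))
  where
  N : ℕ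
  N = bound ef ℕ.+ bound eg

AtOne-+P : ∀ {f g c d} → AtOne f c → AtOne g d → AtOne (f +P g) (c + d)
AtOne-+P {f} {g} ef eg = record
  { bound    = N
  ; vanishes = λ n le → cong₂ _+_ (stable-weaken ≤N₁ (vanishes ef) n le) (stable-weaken ≤N₂ (vanishes eg) n le)
  ; sums     = λ n le → trans (PS-+P f g n)
                          (cong₂ _+_ (stable-weaken ≤N₁ (sums ef) n le) (stable-weaken ≤N₂ (sums eg) n le))
  }
  where
  N : ℕ
  N = bound ef ℕ.+ bound eg
  ≤N₁ : bound ef ≤ N
  ≤N₁ = m≤m+n _ _
  ≤N₂ : bound eg ≤ N
  ≤N₂ = m≤n+m _ _

AtOne-*P : ∀ {f g α β} → AtOne f α → AtOne g β → AtOne (f *P g) (α * β)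
AtOne-*P {f} {g} {α} {β} ef eg = record
  { bound    = A ℕ.+ bound eg
  ; vanishes = λ n le → trans (*P-stable A _ f g 0ℤ (vanishes ef) (vanishes eg) n le) (*-zeroʳ (sumTo A f))
  ; sums     = λ n le → trans (PS-*P f g n)
                 (trans (*P-stable A _ f (PS g) β (vanishes ef) (sums eg) n le) (cong (_* β) total))
  }
  where
  A : ℕ
  A = bound ef
  total : sumTo A f ≡ α
  total = trans (sym (PS-stable A f (vanishes ef) A ≤-refl)) (sums ef A ≤-refl)

Δ-vanishes : ∀ {g N} → StableFrom g N 0ℤ → StableFrom (Δ g) (suc N) 0ℤ
Δ-vanishes van (suc n) (s≤s N≤n) = cong₂ _-_ (van (suc n) (≤-trans N≤n (n≤1+n n))) (van n N≤n)

Δⁿ-vanishes : ∀ k {g N} → StableFrom g N 0ℤ → StableFrom (Δⁿ k g) (k ℕ.+ N) 0ℤ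
Δⁿ-vanishes zero van = van
Δⁿ-vanishes (suc k) van = Δ-vanishes (Δⁿ-vanishes k van)

AtOne-Δ : ∀ {g N} → StableFrom g N 0ℤ → AtOne (Δ g) 0ℤ
AtOne-Δ {g} {N} van = record
  { bound    = suc N
  ; vanishes = Δ-vanishes van
  ; sums     = λ n le → trans (PS-Δ g n) (van n (≤-trans (n≤1+n N) le))
  }

AtOne-qPow : ∀ m → AtOne (qPow m) 1ℤ
AtOne-qPow m = subst (AtOne (qPow m)) (total m) (AtOne-total (suc m) (vanishes-after m))
  where
  vanishes-after : ∀ m → StableFrom (qPow m) (suc m) 0ℤ
  vanishes-after zero (suc n) _ = refl
  vanishes-after (suc m) (suc n) (s≤s le) = vanishes-after m n le
  total : ∀ m → sumTo (suc m) (qPow m) ≡ 1ℤ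
  total zero = refl
  total (suc m) = cong (_+_ 0ℤ) (total m)

AtOne-geom : ∀ v → AtOne (geom v) (+ v)
AtOne-geom v = subst (AtOne (geom v)) (total v) (AtOne-total v (vanishes-after v))
  where
  vanishes-after : ∀ v → StableFrom (geom v) v 0ℤ
  vanishes-after zero n _ = refl
  vanishes-after (suc v) (suc n) (s≤s le) = vanishes-after v n le
  total : ∀ v → sumTo v (geom v) ≡ + v
  total zero = refl
  total (suc v) = cong (_+_ 1ℤ) (total v)

AtOne-Q : ∀ V → AtOne (Q V) (+ product V)
AtOne-Q [] = AtOne-qPow 0
AtOne-Q (v ∷ V) = subst (AtOne (Q (v ∷ V))) (sym (pos-* v (product V)))
  (AtOne-*P (AtOne-geom v) (AtOne-Q V))

AtOne-sumQPow : ∀ ms → AtOne (sumQPow ms) (+ length ms)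
AtOne-sumQPow [] = record { bound = 0 ; vanishes = λ _ _ → refl ; sums = λ n _ → PS-zero (λ _ → refl) n }
AtOne-sumQPow (m ∷ ms) = AtOne-+P (AtOne-qPow m) (AtOne-sumQPow ms)

-- Cancelling the common power of
-- 1 - q leaves either X = Y or an extra factor 1 - q on one side, which
-- would make that side's value at 1 zero.
balance : ∀ a b {X Y x y} → AtOne X x → AtOne Y y → x ≢ 0ℤ → y ≢ 0ℤ →
          Δⁿ b X ≈ Δⁿ a Y → a ≡ b × x ≡ y
balance a b {X} {Y} eX eY x≢0 y≢0 e with compare a b
... | equal a = refl , AtOne-unique eX eY (Δⁿ-injective a e)
... | less a k = contradiction (sym (AtOne-unique (AtOne-Δ (Δⁿ-vanishes k (vanishes eX))) eY
        (Δⁿ-injective a (subst (_≈ Δⁿ a Y) (Δⁿ-peel a k X) e)))) y≢0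
... | greater b k = contradiction (AtOne-unique eX (AtOne-Δ (Δⁿ-vanishes k (vanishes eY)))
        (Δⁿ-injective b (subst (Δⁿ b X ≈_) (Δⁿ-peel b k Y) e))) x≢0

nonzero-pos : ∀ n → .{{NonZero n}} → + n ≢ 0ℤ
nonzero-pos n eq = ≢-nonZero⁻¹ n (+-injective eq)

positive-product : ∀ {V} → All (1 ≤_) V → NonZero (product V)
positive-product pos = product≢0 (All.map >-nonZero pos)

lemma3p2 : (r : ℕ) (m : Fin r → ℕ) (V₊ V₋ : List ℕ) →
    (∀ i → 1 ≤ m i) →
    (∀ i j → toℕ i ≤ toℕ j → m i ≤ m j) →
    All (1 ≤_) V₊ → All (1 ≤_) V₋ →
    (∀ n → (sumQPow (toList m) *P prodOneMinus V₋) n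
    ≡ (qPow 1 *P prodOneMinus V₊) n) →
    (product V₊ ≡ r ℕ.* product V₋) × (length V₊ ≡ length V₋)
lemma3p2 zero m V₊ V₋ _ _ pos₊ _ hyp = contradiction coefficient-of-q (λ ())
  where
  -- For r = 0 the coefficient of q¹ is 0 on the left and Π (1 - 0) = 1 on the right.
  coefficient-of-q : 0ℤ ≡ 1ℤ
  coefficient-of-q = begin
    0ℤ                                   ≡⟨ sym (*P-zeroˡ 0P (prodOneMinus V₋) (λ _ → refl) 1) ⟩
    (0P *P prodOneMinus V₋) 1            ≡⟨ hyp 1 ⟩
    (qPow 1 *P prodOneMinus V₊) 1        ≡⟨ *P-qPowˡ 1 (prodOneMinus V₊) 1 ⟩
    prodOneMinus V₊ 0                    ≡⟨ prodOneMinus-constant pos₊ ⟩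
    1ℤ                                   ∎
    where open ≡-Reasoning
lemma3p2 (suc r) m V₊ V₋ _ _ pos₊ pos₋ hyp =
  conclude (balance (length V₊) (length V₋) value₋ value₊
             (nonzero-pos _ {{m*n≢0 (suc r) (product V₋) {{_}} {{positive-product pos₋}}}})
             (nonzero-pos _ {{positive-product pos₊}})
             balanced)
  where
  S : Poly
  S = sumQPow (toList m)
  balanced : Δⁿ (length V₋) (S *P Q V₋) ≈ Δⁿ (length V₊) (qPow 1 *P Q V₊)
  balanced n = trans (sym (*P-prodOneMinus S V₋ n)) (trans (hyp n) (*P-prodOneMinus (qPow 1) V₊ n))
  value₋ : AtOne (S *P Q V₋) (+ (suc r ℕ.* product V₋))
  value₋ = subst (AtOne (S *P Q V₋))
    (trans (cong (λ l → + l * + product V₋) (length-tabulate m)) (sym (pos-* (suc r) (product V₋))))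
    (AtOne-*P (AtOne-sumQPow (toList m)) (AtOne-Q V₋))
  value₊ : AtOne (qPow 1 *P Q V₊) (+ product V₊)
  value₊ = subst (AtOne (qPow 1 *P Q V₊)) (*-identityˡ _) (AtOne-*P (AtOne-qPow 1) (AtOne-Q V₊))
  conclude : length V₊ ≡ length V₋ × + (suc r ℕ.* product V₋) ≡ + product V₊ →
             (product V₊ ≡ suc r ℕ.* product V₋) × (length V₊ ≡ length V₋)
  conclude (lengths , values) = sym (+-injective values) , lengths
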